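{- Let $n,k\in\mathbb{N}$ with $n\ge 3$ and $k\ge 2$, and let $MC_n^k$ be the multilayered cycle. Then the Cartesian vertex span satisfies $\sigma^{\square}_V(MC_n^k)=\left\lfloor\frac{n}{2}\right\rfloor$.
   Context: For $n\ge3$, $k\ge2$, the multilayered cycle $MC_n^k$ is the graph with vertex set $\{(i,j): i\in\mathbb{Z}_n,\ j\in\{1,\dots,k\}\}$ in which $(a,b)$ and $(c,d)$ are adjacent iff either $a=c$ and $|d-b|=1$, or $b=d$ and $a-c\equiv\pm1 \pmod n$. Write $\mathbb{N}_l=\{1,\dots,l\}$ and let $d$ denote the shortest-path distance in the graph. For a graph $G$ and $l\in\mathbb{N}$, a lazy $l$-track is a surjective map $f:\mathbb{N}_l\to V(G)$ with $f(i)f(i+1)\in E(G)$ or $f(i)=f(i+1)$ for all $i\in\mathbb{N}_{l-1}$. Two lazy $l$-tracks $f,g$ are opposite if for every $i\in\mathbb{N}_{l-1}$: $f(i)f(i+1)\in E(G)$ if and only if $g(i)=g(i+1)$. For maps $f,g:\mathbb{N}_l\to V(G)$ set $m_G(f,g)=\min\{d(f(i),g(i)): i\in\mathbb{N}_l\}$. The Cartesian vertex span $\sigma^{\square}_V(G)$ is the maximum of $m_G(f,g)$ over all $l\in\mathbb{N}$ and all pairs $f,g$ of opposite lazy $l$-tracks on $G$. -}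

module Defs where

open import Level using (0ℓ)
open import Data.Nat using (ℕ; zero; suc; _≤_; _<_; _/_)
open import Data.Fin using (Fin; toℕ)
open import Data.Product using (Σ; _×_; _,_; ∃)
open import Data.Sum using (_⊎_)
open import Relation.Binary.PropositionalEquality using (_≡_)
open import Function.Bundles using (_⇔_)

record Graph : Set₁ where
  field
    V   : Set
    Adj : V → V → Set
open Graph public

data Walk (G : Graph) : V G → V G → ℕ → Set where
  here : ∀ {u} → Walk G u u zero
  step : ∀ {u v w m} → Adj G u v → Walk G v w m → Walk G u w (suc m)

IsDist : (G : Graph) → V G → V G → ℕ → Set
IsDist G u v m = Walk G u v m × (∀ m' → Walk G u v m' → m ≤ m')

-- Consecutive indices: ℕ_l = {1,…,l} is modelled by Fin l = {0,…,l-1};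
-- (i , j) consecutive means j = i + 1.
Consec : {l : ℕ} → Fin l → Fin l → Set
Consec i j = toℕ j ≡ suc (toℕ i)

IsLazyTrack : (G : Graph) (l : ℕ) → (Fin l → V G) → Set
IsLazyTrack G l f =
  (∀ v → ∃ λ i → f i ≡ v) ×
  (∀ i j → Consec i j → Adj G (f i) (f j) ⊎ f i ≡ f j)

Opposite : (G : Graph) (l : ℕ) → (Fin l → V G) → (Fin l → V G) → Set
Opposite G l f g =
  ∀ i j → Consec i j → (Adj G (f i) (f j) ⇔ (g i ≡ g j))

IsMinDist : (G : Graph) (l : ℕ) → (Fin l → V G) → (Fin l → V G) → ℕ → Set
IsMinDist G l f g m =
  (∃ λ i → IsDist G (f i) (g i) m) ×
  (∀ i d → IsDist G (f i) (g i) d → m ≤ d)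

IsCartesianVertexSpan : Graph → ℕ → Set
IsCartesianVertexSpan G s =
  (Σ ℕ λ l → Σ (Fin l → V G) λ f → Σ (Fin l → V G) λ g →
     IsLazyTrack G l f × IsLazyTrack G l g × Opposite G l f g × IsMinDist G l f g s)
  ×
  (∀ l (f g : Fin l → V G) → IsLazyTrack G l f → IsLazyTrack G l g →
     Opposite G l f g → ∀ m → IsMinDist G l f g m → m ≤ s)

-- Cyclic adjacency in ℤ_n (elements represented by 0,…,n-1): a - c ≡ ±1 (mod n).
CycAdj : (n : ℕ) → Fin n → Fin n → Set
CycAdj n a c =
  (toℕ c ≡ suc (toℕ a)) ⊎ (toℕ a ≡ suc (toℕ c)) ⊎
  ((toℕ c ≡ 0) × (suc (toℕ a) ≡ n)) ⊎ ((toℕ a ≡ 0) × (suc (toℕ c) ≡ n))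

-- Path adjacency on layers {1,…,k} (represented by 0,…,k-1): |d - b| = 1.
PathAdj : (k : ℕ) → Fin k → Fin k → Set
PathAdj k b d = (toℕ d ≡ suc (toℕ b)) ⊎ (toℕ b ≡ suc (toℕ d))

MC : ℕ → ℕ → Graph
MC n k = record
  { V   = Fin n × Fin k
  ; Adj = λ { (a , b) (c , d) →
        (a ≡ c × PathAdj k b d) ⊎ (b ≡ d × CycAdj n a c) }
  }

-- Upper bound: along two opposite lazy tracks exactly one token moves per step, so the layer
-- indices of the tokens change one at a time and by at most one.  Both tracks visit the bottom
-- layer, hence at some moment the tokens are in the same layer, where any two vertices are at
-- most ⌊n/2⌋ apart.
-- Lower bound: keep the tokens at antipodal columns and let them walk around the cycle in
-- turns while they sit in adjacent layers; after a sweep the first token moves up or down into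
-- the layer of the second one, which then moves on.  With the tokens on consecutive terms of
-- the layer sequence 1, 0, 1, 2, …, k-1, k-2, each token sweeps every layer, and their
-- distance never drops below ⌊n/2⌋.

module Submission where

open import Defs
open import Data.Nat
  using (ℕ; zero; suc; _+_; _∸_; _≤_; _<_; _/_; _%_; _⊓_; ∣_-_∣; pred; NonZero; >-nonZero;
         z≤n; s≤s; s≤s⁻¹; _≟_; _≤?_; _<?_)
open import Data.Nat.Properties
open import Data.Nat.DivMod
open import Data.Fin using (Fin; toℕ; fromℕ<; zero; suc)
open import Data.Fin.Properties using (toℕ-injective; toℕ-fromℕ<; toℕ<n)
open import Data.List using (List; []; _∷_; length; lookup)
open import Data.List.Relation.Unary.Any using (Any; here; there; index)
open import Data.List.Relation.Unary.Any.Properties using (lookup-index)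
open import Data.Product using (Σ; _×_; _,_; ∃; proj₁; proj₂)
import Data.Product as Product
open import Data.Sum using (_⊎_; inj₁; inj₂)
import Data.Sum as Sum
open import Data.Empty using (⊥-elim)
open import Relation.Nullary using (Dec; yes; no)
open import Relation.Binary.Definitions using (Irreflexive)
open import Relation.Binary.PropositionalEquality
open import Function using (_∘_)
open import Function.Bundles using (mk⇔; Equivalence)

-- Arithmetic

n/2-bounds : ∀ n → n / 2 + n / 2 ≤ n × n ≤ suc (n / 2 + n / 2)
n/2-bounds n = subst (n / 2 + n / 2 ≤_) (sym n≡) (m≤n+m _ (n % 2))
             , subst (_≤ suc (n / 2 + n / 2)) (sym n≡) (+-monoˡ-≤ _ (s≤s⁻¹ (m%n<n n 2)))
  where
    n≡ : n ≡ n % 2 + (n / 2 + n / 2)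
    n≡ = trans (m≡m%n+[m/n]*n n 2)
               (cong (n % 2 +_) (trans (*-comm (n / 2) 2) (cong (n / 2 +_) (+-identityʳ (n / 2)))))

m⊓[n∸m]≤n/2 : ∀ n m → m ⊓ (n ∸ m) ≤ n / 2
m⊓[n∸m]≤n/2 n m with m ≤? n / 2
... | yes m≤h = ≤-trans (m⊓n≤m m (n ∸ m)) m≤h
... | no m≰h  = ≤-trans (m⊓n≤n m (n ∸ m)) (begin
  n ∸ m                         ≤⟨ ∸-monoʳ-≤ n (≰⇒> m≰h) ⟩
  n ∸ suc (n / 2)               ≤⟨ ∸-monoˡ-≤ (suc (n / 2)) (proj₂ (n/2-bounds n)) ⟩
  suc (n / 2 + n / 2) ∸ suc (n / 2) ≡⟨ m+n∸n≡m (n / 2) (n / 2) ⟩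
  n / 2                         ∎)
  where open ≤-Reasoning

m≤n/2⇒m⊓[n∸m]≡m : ∀ {n m} → m ≤ n / 2 → m ⊓ (n ∸ m) ≡ m
m≤n/2⇒m⊓[n∸m]≡m {n} {m} m≤h = m≤n⇒m⊓n≡m (≤-trans m≤h (≤-trans h≤n∸h (∸-monoʳ-≤ n m≤h)))
  where h≤n∸h = m+n≤o⇒m≤o∸n (n / 2) (proj₁ (n/2-bounds n))

m≤1+n⇒o∸n≤1+o∸m : ∀ o {m n} → m ≤ suc n → o ∸ n ≤ suc (o ∸ m)
m≤1+n⇒o∸n≤1+o∸m o {m} m≤1+n = ≤-trans (∸-monoʳ-≤ (suc o) m≤1+n)
  (m≤n+o⇒m∸n≤o (suc o) m (subst (suc o ≤_) (sym (+-suc m (o ∸ m))) (s≤s (m≤n+m∸n o m))))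

m⊓1+n≤1+n⊓1+m : ∀ m n → m ⊓ suc n ≤ suc (n ⊓ suc m)
m⊓1+n≤1+n⊓1+m m n = subst (_≤ suc (n ⊓ suc m)) (⊓-comm (suc n) m)
  (⊓-mono-≤ (≤-refl {suc n}) (≤-trans (n≤1+n m) (n≤1+n (suc m))))

adjacent⇒≤1+ : ∀ {x y} → y ≡ suc x ⊎ x ≡ suc y → x ≤ suc y
adjacent⇒≤1+ {x} (inj₁ refl) = ≤-trans (n≤1+n x) (n≤1+n (suc x))
adjacent⇒≤1+ (inj₂ refl) = ≤-refl

adjacent⇒∣m-n∣≡1 : ∀ {x y} → y ≡ suc x ⊎ x ≡ suc y → ∣ x - y ∣ ≡ 1
adjacent⇒∣m-n∣≡1 {x} (inj₁ refl) = trans (m≤n⇒∣m-n∣≡n∸m (n≤1+n x)) (m+n∸n≡m 1 x)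
adjacent⇒∣m-n∣≡1 {y = y} (inj₂ refl) = trans (m≤n⇒∣n-m∣≡n∸m (n≤1+n y)) (m+n∸n≡m 1 y)

∣-∣-adjacent : ∀ {x y} z → y ≡ suc x ⊎ x ≡ suc y → ∣ x - z ∣ ≤ suc ∣ y - z ∣
∣-∣-adjacent {x} {y} z x~y =
  ≤-trans (∣-∣-triangle x y z) (≤-reflexive (cong (_+ ∣ y - z ∣) (adjacent⇒∣m-n∣≡1 x~y)))

module _ {d : ℕ} .{{_ : NonZero d}} where

  [m+n%d]%d≡[m+n]%d : ∀ m n → (m + n % d) % d ≡ (m + n) % d
  [m+n%d]%d≡[m+n]%d m n = begin
    (m + n % d) % d           ≡⟨ %-distribˡ-+ m (n % d) d ⟩
    (m % d + n % d % d) % d   ≡⟨ cong (λ t → (m % d + t) % d) (m%n%n≡m%n n d) ⟩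
    (m % d + n % d) % d       ≡⟨ %-distribˡ-+ m n d ⟨
    (m + n) % d               ∎
    where open ≡-Reasoning

  [m%d+n]%d≡[m+n]%d : ∀ m n → (m % d + n) % d ≡ (m + n) % d
  [m%d+n]%d≡[m+n]%d m n = begin
    (m % d + n) % d ≡⟨ cong (_% d) (+-comm (m % d) n) ⟩
    (n + m % d) % d ≡⟨ [m+n%d]%d≡[m+n]%d n m ⟩
    (n + m) % d     ≡⟨ cong (_% d) (+-comm n m) ⟩
    (m + n) % d     ∎
    where open ≡-Reasoning

  shift-to : ∀ x y → y < d → ∃ λ j → j < d × (j + x) % d ≡ y
  shift-to x y y<d = (y + (d ∸ r)) % d , m%n<n _ d , (begin
    ((y + (d ∸ r)) % d + x) % d ≡⟨ [m%d+n]%d≡[m+n]%d (y + (d ∸ r)) x ⟩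
    (y + (d ∸ r) + x) % d       ≡⟨ [m+n%d]%d≡[m+n]%d (y + (d ∸ r)) x ⟨
    (y + (d ∸ r) + r) % d       ≡⟨ cong (_% d) (+-assoc y (d ∸ r) r) ⟩
    (y + ((d ∸ r) + r)) % d     ≡⟨ cong (λ t → (y + t) % d) (m∸n+n≡m (<⇒≤ (m%n<n x d))) ⟩
    (y + d) % d                 ≡⟨ [m+n]%n≡m%n y d ⟩
    y % d                       ≡⟨ m<n⇒m%n≡m y<d ⟩
    y                           ∎)
    where
      open ≡-Reasoning
      r = x % d

-- Graphs: walks, opposite tracks and runs

module WalkLowerBound {G : Graph} (D : V G → V G → ℕ) (D-refl : ∀ v → D v v ≡ 0)
                      (D-step : ∀ {u w} v → Adj G u w → D u v ≤ suc (D w v)) where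

  D≤length : ∀ {u v m} → Walk G u v m → D u v ≤ m
  D≤length {v = v} here = ≤-reflexive (D-refl v)
  D≤length {v = v} (step u~w walk) = ≤-trans (D-step v u~w) (s≤s (D≤length walk))

  isDist : ∀ {u v m} → D u v ≡ m → Walk G u v m → IsDist G u v m
  isDist refl walk = walk , λ _ → D≤length

module _ (G : Graph) where

  LazySteps : (l : ℕ) → (Fin l → V G) → Set
  LazySteps l f = ∀ i j → Consec i j → Adj G (f i) (f j) ⊎ f i ≡ f j

  Step : V G × V G → V G × V G → Set
  Step (u , v) (u' , v') = (Adj G u u' × v ≡ v') ⊎ (u ≡ u' × Adj G v v')

  ExactlyOneMoves : (l : ℕ) → (Fin l → V G) → (Fin l → V G) → Set
  ExactlyOneMoves l f g = ∀ i j → Consec i j → Step (f i , g i) (f j , g j)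

module _ {G : Graph} {l : ℕ} {f g : Fin l → V G} where

  exactlyOneMoves-swap : ExactlyOneMoves G l f g → ExactlyOneMoves G l g f
  exactlyOneMoves-swap moves i j c = Sum.swap (Sum.map Product.swap Product.swap (moves i j c))

  exactlyOneMoves⇒lazyˡ : ExactlyOneMoves G l f g → LazySteps G l f
  exactlyOneMoves⇒lazyˡ moves i j c = Sum.map proj₁ proj₁ (moves i j c)

  exactlyOneMoves⇒lazyʳ : ExactlyOneMoves G l f g → LazySteps G l g
  exactlyOneMoves⇒lazyʳ moves i j c = Sum.swap (Sum.map proj₂ proj₂ (moves i j c))

  exactlyOneMoves⇒opposite : Irreflexive _≡_ (Adj G) → ExactlyOneMoves G l f g → Opposite G l f g
  exactlyOneMoves⇒opposite irrefl moves i j c with moves i j c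
  ... | inj₁ (f~ , g≡) = mk⇔ (λ _ → g≡) (λ _ → f~)
  ... | inj₂ (f≡ , g~) = mk⇔ (λ f~ → ⊥-elim (irrefl f≡ f~)) (λ g≡ → ⊥-elim (irrefl g≡ g~))

  opposite⇒exactlyOneMoves : Irreflexive _≡_ (Adj G) → LazySteps G l f → LazySteps G l g →
                             Opposite G l f g → ExactlyOneMoves G l f g
  opposite⇒exactlyOneMoves irrefl f-lazy g-lazy opp i j c with f-lazy i j c | g-lazy i j c
  ... | inj₁ f~ | _      = inj₁ (f~ , Equivalence.to (opp i j c) f~)
  ... | inj₂ f≡ | inj₁ g~ = inj₂ (f≡ , g~)
  ... | inj₂ f≡ | inj₂ g≡ = ⊥-elim (irrefl f≡ (Equivalence.from (opp i j c) g≡))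

crossing-point : ∀ {l} (u v : Fin l → ℕ) → (∀ i j → Consec i j → u i < v i → u j ≤ v j) →
                 ∀ i j → toℕ i ≤ toℕ j → u i ≤ v i → v j ≤ u j → ∃ λ t → u t ≡ v t
crossing-point {l} u v no-overtaking i j i≤j = go (toℕ j ∸ toℕ i) i (m+[n∸m]≡n i≤j)
  where
    go : ∀ d i → toℕ i + d ≡ toℕ j → u i ≤ v i → v j ≤ u j → ∃ λ t → u t ≡ v t
    go zero i i≡j ui≤vi vj≤uj with toℕ-injective (trans (sym (+-identityʳ (toℕ i))) i≡j)
    ... | refl = i , ≤-antisym ui≤vi vj≤uj
    go (suc d) i i+d≡j ui≤vi vj≤uj with u i ≟ v i
    ... | yes ui≡vi = i , ui≡vi
    ... | no ui≢vi  = go d (fromℕ< 1+i<l) next+d≡j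
                         (no-overtaking i _ (toℕ-fromℕ< 1+i<l) (≤∧≢⇒< ui≤vi ui≢vi)) vj≤uj
      where
        1+i<l : suc (toℕ i) < l
        1+i<l = ≤-<-trans (≤-trans (m<m+n (toℕ i) (s≤s z≤n)) (≤-reflexive i+d≡j)) (toℕ<n j)
        next+d≡j : toℕ (fromℕ< 1+i<l) + d ≡ toℕ j
        next+d≡j = trans (cong (_+ d) (toℕ-fromℕ< 1+i<l)) (trans (sym (+-suc (toℕ i) d)) i+d≡j)

module _ {G : Graph} (level : V G → ℕ)
         (level-step : ∀ {u w} → Adj G u w → level w ≤ suc (level u) × level u ≤ suc (level w))
         {l : ℕ} where

  lower-level-catches-up : ∀ {f g : Fin l → V G} → ExactlyOneMoves G l f g →
    ∀ i j → Consec i j → level (f i) < level (g i) → level (f j) ≤ level (g j)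
  lower-level-catches-up {f} {g} moves i j c below with moves i j c
  ... | inj₁ (f~ , g≡) = ≤-trans (proj₁ (level-step f~)) (subst (λ w → _ ≤ level w) g≡ below)
  ... | inj₂ (f≡ , g~) =
    s≤s⁻¹ (≤-trans (subst (λ w → suc (level w) ≤ _) f≡ below) (proj₂ (level-step g~)))

  levels-meet : ∀ {f g : Fin l → V G} → ExactlyOneMoves G l f g → ∀ t₀ t₁ →
    level (f t₀) ≤ level (g t₀) → level (g t₁) ≤ level (f t₁) → ∃ λ t → level (f t) ≡ level (g t)
  levels-meet {f} {g} moves t₀ t₁ f≤g g≤f with ≤-total (toℕ t₀) (toℕ t₁)
  ... | inj₁ t₀≤t₁ =
    crossing-point (level ∘ f) (level ∘ g) (lower-level-catches-up moves) t₀ t₁ t₀≤t₁ f≤g g≤f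
  ... | inj₂ t₁≤t₀ = Product.map₂ sym (crossing-point (level ∘ g) (level ∘ f)
    (lower-level-catches-up (exactlyOneMoves-swap {G = G} moves)) t₁ t₀ t₁≤t₀ g≤f f≤g)

module _ (G : Graph) (P : V G × V G → Set) where

  data Run : V G × V G → Set where
    stop : ∀ {s} → P s → Run s
    move : ∀ {s s'} → P s → Step G s s' → Run s' → Run s

module _ {G : Graph} {P : V G × V G → Set} where

  states : ∀ {s} → Run G P s → List (V G × V G)
  states (stop {s} _) = s ∷ []
  states (move {s} _ _ r) = s ∷ states r

  states-head : ∀ {Q : V G × V G → Set} {s} (r : Run G P s) → Q s → Any Q (states r)
  states-head (stop _) q = here q
  states-head (move _ _ _) q = here q

  states-invariant : ∀ {s} (r : Run G P s) i → P (lookup (states r) i)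
  states-invariant (stop p) zero = p
  states-invariant (move p _ _) zero = p
  states-invariant (move _ _ r) (suc i) = states-invariant r i

  states-steps : ∀ {s} (r : Run G P s) → ExactlyOneMoves G (length (states r))
                   (proj₁ ∘ lookup (states r)) (proj₂ ∘ lookup (states r))
  states-steps (stop _) zero zero ()
  states-steps (move _ st (stop _)) zero (suc zero) _ = st
  states-steps (move _ st (move _ _ _)) zero (suc zero) _ = st
  states-steps (move _ _ r) (suc i) (suc j) c = states-steps r i j (suc-injective c)

  run-tracks : Irreflexive _≡_ (Adj G) → ∀ {s} (r : Run G P s) →
    (∀ v → Any (λ p → proj₁ p ≡ v) (states r)) → (∀ v → Any (λ p → proj₂ p ≡ v) (states r)) →
    let l = length (states r) ; f = proj₁ ∘ lookup (states r) ; g = proj₂ ∘ lookup (states r) in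
    IsLazyTrack G l f × IsLazyTrack G l g × Opposite G l f g
  run-tracks irrefl r coversˡ coversʳ =
      ((λ v → index (coversˡ v) , lookup-index (coversˡ v)) , exactlyOneMoves⇒lazyˡ {G = G} moves)
    , ((λ v → index (coversʳ v) , lookup-index (coversʳ v)) , exactlyOneMoves⇒lazyʳ {G = G} moves)
    , exactlyOneMoves⇒opposite {G = G} irrefl moves
    where moves = states-steps r

-- The cycle ℤ_n

module Cycle (n : ℕ) .{{_ : NonZero n}} where

  col : ℕ → Fin n
  col x = x mod n

  toℕ-col : ∀ x → toℕ (col x) ≡ x % n
  toℕ-col x = toℕ-fromℕ< (m%n<n x n)

  toℕ-col-< : ∀ {x} → x < n → toℕ (col x) ≡ x
  toℕ-col-< {x} x<n = trans (toℕ-col x) (m<n⇒m%n≡m x<n)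

  col-≡ : ∀ {x} {a : Fin n} → x % n ≡ toℕ a → col x ≡ a
  col-≡ {x} x≡a = toℕ-injective (trans (toℕ-col x) x≡a)

  col-cong : ∀ {x y} → x % n ≡ y % n → col x ≡ col y
  col-cong {y = y} x≡y = col-≡ (trans x≡y (sym (toℕ-col y)))

  col-toℕ : ∀ a → col (toℕ a) ≡ a
  col-toℕ a = col-≡ (m<n⇒m%n≡m (toℕ<n a))

  col-adj : ∀ x → CycAdj n (col x) (col (suc x))
  col-adj x with m≤n⇒m<n∨m≡n (m%n<n x n)
  ... | inj₁ 1+r<n = inj₁ (begin
    toℕ (col (suc x)) ≡⟨ toℕ-col (suc x) ⟩
    suc x % n         ≡⟨ [m+n%d]%d≡[m+n]%d 1 x ⟨
    suc (x % n) % n   ≡⟨ m<n⇒m%n≡m 1+r<n ⟩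
    suc (x % n)       ≡⟨ cong suc (toℕ-col x) ⟨
    suc (toℕ (col x)) ∎)
    where open ≡-Reasoning
  ... | inj₂ 1+r≡n = inj₂ (inj₂ (inj₁ (wraps , trans (cong suc (toℕ-col x)) 1+r≡n)))
    where
      open ≡-Reasoning
      wraps : toℕ (col (suc x)) ≡ 0
      wraps = begin
        toℕ (col (suc x)) ≡⟨ toℕ-col (suc x) ⟩
        suc x % n         ≡⟨ [m+n%d]%d≡[m+n]%d 1 x ⟨
        suc (x % n) % n   ≡⟨ cong (_% n) 1+r≡n ⟩
        n % n             ≡⟨ n%n≡0 n ⟩
        0                 ∎

  CycAdj-sym : ∀ {a c} → CycAdj n a c → CycAdj n c a
  CycAdj-sym (inj₁ e) = inj₂ (inj₁ e)
  CycAdj-sym (inj₂ (inj₁ e)) = inj₁ e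
  CycAdj-sym (inj₂ (inj₂ (inj₁ e))) = inj₂ (inj₂ (inj₂ e))
  CycAdj-sym (inj₂ (inj₂ (inj₂ e))) = inj₂ (inj₂ (inj₁ e))

  cycDist : ℕ → ℕ → ℕ
  cycDist x y = ∣ x - y ∣ ⊓ (n ∸ ∣ x - y ∣)

  cycDist-adjacent : ∀ {x y} z → y ≡ suc x ⊎ x ≡ suc y → cycDist x z ≤ suc (cycDist y z)
  cycDist-adjacent z x~y =
    ⊓-mono-≤ (∣-∣-adjacent z x~y) (m≤1+n⇒o∸n≤1+o∸m n (∣-∣-adjacent z (Sum.swap x~y)))

  cycDist-wrap : ∀ {x z} → suc x ≡ n → z < n →
                 cycDist x z ≤ suc (cycDist 0 z) × cycDist 0 z ≤ suc (cycDist x z)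
  cycDist-wrap {x} {z} 1+x≡n z<n =
      subst₂ (λ a b → a ≤ suc b) (sym last) (sym first) (m⊓1+n≤1+n⊓1+m (x ∸ z) z)
    , subst₂ (λ a b → a ≤ suc b) (sym first) (sym last) (m⊓1+n≤1+n⊓1+m z (x ∸ z))
    where
      z≤x : z ≤ x
      z≤x = s≤s⁻¹ (subst (z <_) (sym 1+x≡n) z<n)
      last : cycDist x z ≡ (x ∸ z) ⊓ suc z
      last = begin
        ∣ x - z ∣ ⊓ (n ∸ ∣ x - z ∣) ≡⟨ cong (λ t → t ⊓ (n ∸ t)) (m≤n⇒∣n-m∣≡n∸m z≤x) ⟩
        (x ∸ z) ⊓ (n ∸ (x ∸ z))     ≡⟨ cong (λ t → (x ∸ z) ⊓ (t ∸ (x ∸ z))) (sym 1+x≡n) ⟩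
        (x ∸ z) ⊓ (suc x ∸ (x ∸ z)) ≡⟨ cong ((x ∸ z) ⊓_) (+-∸-assoc 1 (m∸n≤m x z)) ⟩
        (x ∸ z) ⊓ suc (x ∸ (x ∸ z)) ≡⟨ cong (λ t → (x ∸ z) ⊓ suc t) (m∸[m∸n]≡n z≤x) ⟩
        (x ∸ z) ⊓ suc z             ∎
        where open ≡-Reasoning
      first : cycDist 0 z ≡ z ⊓ suc (x ∸ z)
      first = trans (cong (λ t → z ⊓ (t ∸ z)) (sym 1+x≡n)) (cong (z ⊓_) (+-∸-assoc 1 z≤x))

  cycDist-step : ∀ {a a'} → CycAdj n a a' → ∀ z → z < n → cycDist (toℕ a) z ≤ suc (cycDist (toℕ a') z)
  cycDist-step (inj₁ a~a') z _ = cycDist-adjacent z (inj₁ a~a')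
  cycDist-step (inj₂ (inj₁ a~a')) z _ = cycDist-adjacent z (inj₂ a~a')
  cycDist-step {a} (inj₂ (inj₂ (inj₁ (a'≡0 , 1+a≡n)))) z z<n =
    subst (λ t → cycDist (toℕ a) z ≤ suc (cycDist t z)) (sym a'≡0) (proj₁ (cycDist-wrap 1+a≡n z<n))
  cycDist-step {a' = a'} (inj₂ (inj₂ (inj₂ (a≡0 , 1+a'≡n)))) z z<n =
    subst (λ t → cycDist t z ≤ suc (cycDist (toℕ a') z)) (sym a≡0) (proj₂ (cycDist-wrap 1+a'≡n z<n))

  cycDist-shift : ∀ x j → j ≤ n → cycDist (x % n) ((j + x) % n) ≡ j ⊓ (n ∸ j)
  cycDist-shift x j j≤n = trans (cong (cycDist r) (sym ([m+n%d]%d≡[m+n]%d j x))) (residue (j + r <? n))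
    where
      open ≡-Reasoning
      r = x % n
      via-∣-∣ : ∀ z {d} → ∣ r - z ∣ ≡ d → cycDist r z ≡ d ⊓ (n ∸ d)
      via-∣-∣ _ = cong (λ t → t ⊓ (n ∸ t))
      residue : Dec (j + r < n) → cycDist r ((j + r) % n) ≡ j ⊓ (n ∸ j)
      residue (yes j+r<n) = begin
        cycDist r ((j + r) % n) ≡⟨ cong (cycDist r) (m<n⇒m%n≡m j+r<n) ⟩
        cycDist r (j + r)       ≡⟨ via-∣-∣ (j + r) (trans (m≤n⇒∣m-n∣≡n∸m (m≤n+m r j)) (m+n∸n≡m j r)) ⟩
        j ⊓ (n ∸ j)             ∎
      residue (no j+r≮n) = begin
        cycDist r ((j + r) % n) ≡⟨ cong (cycDist r) wrapped ⟩
        cycDist r (r ∸ e)       ≡⟨ via-∣-∣ (r ∸ e) (trans (m≤n⇒∣n-m∣≡n∸m (m∸n≤m r e)) (m∸[m∸n]≡n e≤r)) ⟩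
        e ⊓ (n ∸ e)             ≡⟨ cong (e ⊓_) (m∸[m∸n]≡n j≤n) ⟩
        e ⊓ j                   ≡⟨ ⊓-comm e j ⟩
        j ⊓ e                   ∎
        where
          e = n ∸ j
          n≤j+r = ≮⇒≥ j+r≮n
          r<n = m%n<n x n
          e≤r : e ≤ r
          e≤r = +-cancelˡ-≤ j e r (subst (_≤ j + r) (sym (m+[n∸m]≡n j≤n)) n≤j+r)
          j+r∸n≡r∸e : j + r ∸ n ≡ r ∸ e
          j+r∸n≡r∸e = trans (cong (j + r ∸_) (sym (m+[n∸m]≡n j≤n))) ([m+n]∸[m+o]≡n∸o j r e)
          wrapped : (j + r) % n ≡ r ∸ e
          wrapped = begin
            (j + r) % n     ≡⟨ m≤n⇒[n∸m]%m≡n%m n≤j+r ⟨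
            (j + r ∸ n) % n ≡⟨ m<n⇒m%n≡m (subst (_< n) (sym j+r∸n≡r∸e) (≤-<-trans (m∸n≤m r e) r<n)) ⟩
            j + r ∸ n       ≡⟨ j+r∸n≡r∸e ⟩
            r ∸ e           ∎

-- The multilayered cycle

module MultilayeredCycle (n k : ℕ) (2≤n : 2 ≤ n) (2≤k : 2 ≤ k) where

  private instance
    n-nonZero : NonZero n
    n-nonZero = >-nonZero (≤-trans (n≤1+n 1) 2≤n)
    k-nonZero : NonZero k
    k-nonZero = >-nonZero (≤-trans (n≤1+n 1) 2≤k)

  h K : ℕ
  h = n / 2
  K = k ∸ 2

  2+K≡k : suc (suc K) ≡ k
  2+K≡k = m+[n∸m]≡n 2≤k

  G : Graph
  G = MC n k

  open Cycle n
  open Cycle k using () renaming (col to layer; col-toℕ to layer-toℕ; toℕ-col-< to toℕ-layer)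

  h≤n : h ≤ n
  h≤n = ≤-trans (m≤m+n h h) (proj₁ (n/2-bounds n))

  1+pred[h]≡h : suc (pred h) ≡ h
  1+pred[h]≡h = suc-pred h ⦃ >-nonZero (m≥n⇒m/n>0 {n} {2} 2≤n) ⦄

  layer-up : ∀ {y} → suc y < k → PathAdj k (layer y) (layer (suc y))
  layer-up {y} 1+y<k = inj₁ (trans (toℕ-layer 1+y<k) (cong suc (sym (toℕ-layer (≤-trans (n≤1+n _) 1+y<k)))))

  layer-down : ∀ {y} → suc y < k → PathAdj k (layer (suc y)) (layer y)
  layer-down 1+y<k = Sum.swap (layer-up 1+y<k)

  horizontal : ∀ {a c b} → CycAdj n a c → Adj G (a , b) (c , b)
  horizontal a~c = inj₂ (refl , a~c)

  vertical : ∀ {a b d} → PathAdj k b d → Adj G (a , b) (a , d)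
  vertical b~d = inj₁ (refl , b~d)

  1≢n : 1 ≢ n
  1≢n = <⇒≢ 2≤n

  irrefl : Irreflexive _≡_ (Adj G)
  irrefl refl (inj₁ (_ , inj₁ e)) = 1+n≢n (sym e)
  irrefl refl (inj₁ (_ , inj₂ e)) = 1+n≢n (sym e)
  irrefl refl (inj₂ (_ , inj₁ e)) = 1+n≢n (sym e)
  irrefl refl (inj₂ (_ , inj₂ (inj₁ e))) = 1+n≢n (sym e)
  irrefl refl (inj₂ (_ , inj₂ (inj₂ (inj₁ (e₀ , e₁))))) = 1≢n (trans (cong suc (sym e₀)) e₁)
  irrefl refl (inj₂ (_ , inj₂ (inj₂ (inj₂ (e₀ , e₁))))) = 1≢n (trans (cong suc (sym e₀)) e₁)

  level : V G → ℕ
  level (_ , b) = toℕ b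

  level-step : ∀ {u w} → Adj G u w → level w ≤ suc (level u) × level u ≤ suc (level w)
  level-step (inj₁ (_ , b~d)) = adjacent⇒≤1+ (Sum.swap b~d) , adjacent⇒≤1+ b~d
  level-step {_ , b} (inj₂ (refl , _)) = n≤1+n (toℕ b) , n≤1+n (toℕ b)

  dist : V G → V G → ℕ
  dist (a , b) (c , d) = cycDist (toℕ a) (toℕ c) + ∣ toℕ b - toℕ d ∣

  dist-refl : ∀ v → dist v v ≡ 0
  dist-refl (a , b) rewrite ∣n-n∣≡0 (toℕ a) | ∣n-n∣≡0 (toℕ b) = refl

  dist-step : ∀ {u w} v → Adj G u w → dist u v ≤ suc (dist w v)
  dist-step {a , b} (c , d) (inj₁ (refl , b~b')) =
    ≤-trans (+-monoʳ-≤ (cycDist (toℕ a) (toℕ c)) (∣-∣-adjacent (toℕ d) b~b')) (≤-reflexive (+-suc _ _))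
  dist-step {a , b} (c , d) (inj₂ (refl , a~a')) =
    +-monoˡ-≤ ∣ toℕ b - toℕ d ∣ (cycDist-step a~a' (toℕ c) (toℕ<n c))

  open WalkLowerBound dist dist-refl (λ {u} {w} → dist-step {u} {w})

  dist-col : ∀ x y b d → dist (col x , b) (col y , d) ≡ cycDist (x % n) (y % n) + ∣ toℕ b - toℕ d ∣
  dist-col x y b d rewrite toℕ-col x | toℕ-col y = refl

  cycDist-shift-≤h : ∀ x j → j ≤ h → cycDist (x % n) ((j + x) % n) ≡ j
  cycDist-shift-≤h x j j≤h = trans (cycDist-shift x j (≤-trans j≤h h≤n)) (m≤n/2⇒m⊓[n∸m]≡m j≤h)

  forward-walk : ∀ x j b → Walk G (col x , b) (col (j + x) , b) j
  forward-walk x zero b = here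
  forward-walk x (suc j) b = step (horizontal (col-adj x))
    (subst (λ t → Walk G (col (suc x) , b) (col t , b) j) (+-suc j x) (forward-walk (suc x) j b))

  backward-walk : ∀ x j b → Walk G (col (j + x) , b) (col x , b) j
  backward-walk x zero b = here
  backward-walk x (suc j) b = step (horizontal (CycAdj-sym (col-adj (j + x)))) (backward-walk x j b)

  layer-walk : ∀ x j b → j ≤ n → Walk G (col x , b) (col (j + x) , b) (j ⊓ (n ∸ j))
  layer-walk x j b j≤n with ≤-total j (n ∸ j)
  ... | inj₁ j≤n∸j = subst (Walk G _ _) (sym (m≤n⇒m⊓n≡m j≤n∸j)) (forward-walk x j b)
  ... | inj₂ n∸j≤j = subst₂ (λ u m → Walk G (u , b) (col (j + x) , b) m)
    (col-cong {(n ∸ j) + (j + x)} {x} around) (sym (m≥n⇒m⊓n≡n n∸j≤j)) (backward-walk (j + x) (n ∸ j) b)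
    where
      open ≡-Reasoning
      around : ((n ∸ j) + (j + x)) % n ≡ x % n
      around = begin
        ((n ∸ j) + (j + x)) % n ≡⟨ cong (_% n) (+-assoc (n ∸ j) j x) ⟨
        ((n ∸ j) + j + x) % n   ≡⟨ cong (λ t → (t + x) % n) (m∸n+n≡m j≤n) ⟩
        (n + x) % n             ≡⟨ cong (_% n) (+-comm n x) ⟩
        (x + n) % n             ≡⟨ [m+n]%n≡m%n x n ⟩
        x % n                   ∎

  layer-isDist : ∀ x j b → j ≤ n → IsDist G (col x , b) (col (j + x) , b) (j ⊓ (n ∸ j))
  layer-isDist x j b j≤n = isDist dist≡ (layer-walk x j b j≤n)
    where
      dist≡ = trans (dist-col x (j + x) b b)
                    (trans (cong₂ _+_ (cycDist-shift x j j≤n) (∣n-n∣≡0 (toℕ b))) (+-identityʳ _))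

  same-level-dist : ∀ u v → level u ≡ level v → Σ ℕ λ d → IsDist G u v d × d ≤ h
  same-level-dist (a , b) (c , d) b≡d with toℕ-injective b≡d | shift-to (toℕ a) (toℕ c) (toℕ<n c)
  ... | refl | j , j<n , e =
    j ⊓ (n ∸ j) ,
    subst₂ (λ u v → IsDist G (u , b) (v , b) _) (col-toℕ a) (col-≡ {j + toℕ a} e)
           (layer-isDist (toℕ a) j b (<⇒≤ j<n)) ,
    m⊓[n∸m]≤n/2 n j

  span-bounded : ∀ l (f g : Fin l → V G) → IsLazyTrack G l f → IsLazyTrack G l g →
                 Opposite G l f g → ∀ m → IsMinDist G l f g m → m ≤ h
  span-bounded l f g (f-onto , f-lazy) (g-onto , g-lazy) opp m (_ , minimal) =
    let moves = opposite⇒exactlyOneMoves {G = G} irrefl f-lazy g-lazy opp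
        (t₀ , f-t₀) = f-onto bottom
        (t₁ , g-t₁) = g-onto bottom
        (t , level≡) = levels-meet {G = G} level level-step moves t₀ t₁
                         (at-bottom (g t₀) f-t₀) (at-bottom (f t₁) g-t₁)
        (d , d-isDist , d≤h) = same-level-dist (f t) (g t) level≡
    in ≤-trans (minimal t d d-isDist) d≤h
    where
      bottom : V G
      bottom = col 0 , layer 0
      at-bottom : ∀ {u} w → u ≡ bottom → level u ≤ level w
      at-bottom w u≡bottom = subst (λ u → level u ≤ level w) (sym u≡bottom)
        (subst (_≤ level w) (sym (toℕ-layer (≤-trans (n≤1+n 1) 2≤k))) z≤n)

  Far : V G × V G → Set
  Far s = h ≤ dist (proj₁ s) (proj₂ s)

  antipodal : ℕ → Fin k → Fin k → V G × V G
  antipodal X p q = (col X , p) , (col (X + h) , q)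

  antipodal-far : ∀ X p q → Far (antipodal X p q)
  antipodal-far X p q = begin
    h                                                 ≡⟨ cycDist-shift-≤h X h ≤-refl ⟨
    cycDist (X % n) ((h + X) % n)                     ≡⟨ cong (λ t → cycDist (X % n) (t % n)) (+-comm h X) ⟩
    cycDist (X % n) ((X + h) % n)                     ≤⟨ m≤m+n _ _ ⟩
    cycDist (X % n) ((X + h) % n) + ∣ toℕ p - toℕ q ∣ ≡⟨ dist-col X (X + h) p q ⟨
    dist (col X , p) (col (X + h) , q)                ∎
    where open ≤-Reasoning

  -- The second token is now one step closer, but they are in different layers.
  closer-far : ∀ X {p q} → PathAdj k p q → Far ((col (suc X) , p) , (col (X + h) , q))
  closer-far X {p} {q} p~q = begin
    h                                 ≡⟨ 1+pred[h]≡h ⟨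
    suc (pred h)                      ≡⟨ cong suc (cycDist-shift-≤h (suc X) (pred h) pred[n]≤n) ⟨
    suc c′                            ≡⟨ cong (λ t → suc (cycDist (suc X % n) (t % n))) shifted ⟩
    suc c                             ≡⟨ +-comm 1 c ⟩
    c + 1                             ≡⟨ cong (c +_) (adjacent⇒∣m-n∣≡1 p~q) ⟨
    c + ∣ toℕ p - toℕ q ∣             ≡⟨ dist-col (suc X) (X + h) p q ⟨
    dist (col (suc X) , p) (col (X + h) , q) ∎
    where
      open ≤-Reasoning
      c = cycDist (suc X % n) ((X + h) % n)
      c′ = cycDist (suc X % n) ((pred h + suc X) % n)
      shifted : pred h + suc X ≡ X + h
      shifted = trans (+-suc (pred h) X) (trans (cong (_+ X) 1+pred[h]≡h) (+-comm h X))

  sweep : ∀ {p q} → PathAdj k p q → ∀ i X → Run G Far (antipodal (i + X) p q) → Run G Far (antipodal X p q)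
  sweep p~q zero X r = r
  sweep {p} {q} p~q (suc i) X r = sweep p~q i X
    (move (antipodal-far (i + X) p q) (inj₁ (horizontal (col-adj (i + X)) , refl))
      (move (closer-far (i + X) p~q) (inj₂ (refl , horizontal (col-adj (i + X + h)))) r))

  change-layers : ∀ X {p q q'} → PathAdj k p q → PathAdj k q q' →
                  Run G Far (antipodal X q q') → Run G Far (antipodal X p q)
  change-layers X {p} {q} p~q q~q' r =
    move (antipodal-far X p q) (inj₁ (vertical p~q , refl)) (move (antipodal-far X q q) (inj₂ (refl , vertical q~q')) r)

  -- Layer pairs (y, y+1), (y+1, y+2), …, (y+d, y+d+1), (y+d+1, y+d).
  climb : ∀ d y X → suc (d + y) < k → Run G Far (antipodal X (layer y) (layer (suc y)))
  climb zero y X top =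
    sweep (layer-up top) n X (change-layers (n + X) (layer-up top) (layer-down top)
      (sweep (layer-down top) n (n + X) (stop (antipodal-far (n + (n + X)) (layer (suc y)) (layer y)))))
  climb (suc d) y X top =
    sweep (layer-up 1+y<k) n X (change-layers (n + X) (layer-up 1+y<k) (layer-up 2+y<k)
      (climb d (suc y) (n + X) (subst (λ t → suc t < k) (sym (+-suc d y)) top)))
    where
      2+y<k : suc (suc y) < k
      2+y<k = ≤-trans (s≤s (s≤s (s≤s (m≤n+m y d)))) top
      1+y<k : suc y < k
      1+y<k = ≤-trans (n≤1+n _) 2+y<k

  tour : Run G Far (antipodal 0 (layer 1) (layer 0))
  tour = sweep (layer-down 1<k) n 0 (change-layers (n + 0) (layer-down 1<k) (layer-up 1<k) (climb K 0 (n + 0) top))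
    where
      1<k : 1 < k
      1<k = 2≤k
      top : suc (K + 0) < k
      top = subst (suc (suc (K + 0)) ≤_) 2+K≡k (s≤s (s≤s (≤-reflexive (+-identityʳ K))))

  sweep-keeps : ∀ {Q : V G × V G → Set} {p q} (p~q : PathAdj k p q) i X (r : Run G Far (antipodal (i + X) p q)) →
                Any Q (states r) → Any Q (states (sweep p~q i X r))
  sweep-keeps p~q zero X r found = found
  sweep-keeps p~q (suc i) X r found = sweep-keeps p~q i X _ (there (there found))

  sweep-visits : ∀ {Q : V G × V G → Set} {p q} (p~q : PathAdj k p q) i X (r : Run G Far (antipodal (i + X) p q)) →
                 ∀ j → j ≤ i → Q (antipodal (j + X) p q) → Any Q (states (sweep p~q i X r))
  sweep-visits p~q zero X r j z≤n found = states-head r found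
  sweep-visits p~q (suc i) X r j j≤1+i found with m≤n⇒m<n∨m≡n j≤1+i
  ... | inj₁ j<1+i = sweep-visits p~q i X _ j (s≤s⁻¹ j<1+i) found
  ... | inj₂ refl = sweep-keeps p~q i X _ (there (there (states-head r found)))

  sweep-coversˡ : ∀ {p q} (p~q : PathAdj k p q) X (r : Run G Far (antipodal (n + X) p q)) (c : Fin n) →
                  Any (λ s → proj₁ s ≡ (c , p)) (states (sweep p~q n X r))
  sweep-coversˡ p~q X r c with shift-to X (toℕ c) (toℕ<n c)
  ... | j , j<n , e = sweep-visits p~q n X r j (<⇒≤ j<n) (cong (_, _) (col-≡ {j + X} e))

  sweep-coversʳ : ∀ {p q} (p~q : PathAdj k p q) X (r : Run G Far (antipodal (n + X) p q)) (c : Fin n) →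
                  Any (λ s → proj₂ s ≡ (c , q)) (states (sweep p~q n X r))
  sweep-coversʳ p~q X r c with shift-to (X + h) (toℕ c) (toℕ<n c)
  ... | j , j<n , e =
    sweep-visits p~q n X r j (<⇒≤ j<n) (cong (_, _) (col-≡ {j + X + h} (trans (cong (_% n) (+-assoc j X h)) e)))

  climb-coversˡ : ∀ d y X top y' → y ≤ y' → y' ≤ suc (d + y) → (c : Fin n) →
                  Any (λ s → proj₁ s ≡ (c , layer y')) (states (climb d y X top))
  climb-coversˡ zero y X top y' y≤y' y'≤1+y c with m≤n⇒m<n∨m≡n y≤y'
  ... | inj₂ refl = sweep-coversˡ _ X _ c
  ... | inj₁ y<y' rewrite ≤-antisym y'≤1+y y<y' = sweep-keeps _ n X _ (there (there (sweep-coversˡ _ (n + X) _ c)))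
  climb-coversˡ (suc d) y X top y' y≤y' y'≤top c with m≤n⇒m<n∨m≡n y≤y'
  ... | inj₂ refl = sweep-coversˡ _ X _ c
  ... | inj₁ y<y' = sweep-keeps _ n X _ (there (there
    (climb-coversˡ d (suc y) (n + X) _ y' y<y' (subst (λ t → y' ≤ suc t) (sym (+-suc d y)) y'≤top) c)))

  climb-coversʳ : ∀ d y X top y' → y < y' → y' ≤ suc (d + y) → (c : Fin n) →
                  Any (λ s → proj₂ s ≡ (c , layer y')) (states (climb d y X top))
  climb-coversʳ zero y X top y' y<y' y'≤1+y c rewrite ≤-antisym y'≤1+y y<y' = sweep-coversʳ _ X _ c
  climb-coversʳ (suc d) y X top y' y<y' y'≤top c with m≤n⇒m<n∨m≡n y<y'
  ... | inj₂ refl = sweep-coversʳ _ X _ c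
  ... | inj₁ 1+y<y' = sweep-keeps _ n X _ (there (there
    (climb-coversʳ d (suc y) (n + X) _ y' 1+y<y' (subst (λ t → y' ≤ suc t) (sym (+-suc d y)) y'≤top) c)))

  toℕ≤top : ∀ (b : Fin k) → toℕ b ≤ suc (K + 0)
  toℕ≤top b = subst (λ t → toℕ b ≤ suc t) (sym (+-identityʳ K))
    (s≤s⁻¹ (subst (toℕ b <_) (sym 2+K≡k) (toℕ<n b)))

  tour-coversˡ : ∀ v → Any (λ s → proj₁ s ≡ v) (states tour)
  tour-coversˡ (c , b) = subst (λ b → Any (λ s → proj₁ s ≡ (c , b)) (states tour)) (layer-toℕ b)
    (sweep-keeps _ n 0 _ (there (there (climb-coversˡ K 0 (n + 0) _ (toℕ b) z≤n (toℕ≤top b) c))))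

  tour-coversʳ : ∀ v → Any (λ s → proj₂ s ≡ v) (states tour)
  tour-coversʳ (c , b) = subst (λ b → Any (λ s → proj₂ s ≡ (c , b)) (states tour)) (layer-toℕ b)
    (covers (toℕ b) (toℕ≤top b))
    where
      covers : ∀ y → y ≤ suc (K + 0) → Any (λ s → proj₂ s ≡ (c , layer y)) (states tour)
      covers zero _ = sweep-coversʳ _ 0 _ c
      covers (suc y) y≤top =
        sweep-keeps _ n 0 _ (there (there (climb-coversʳ K 0 (n + 0) _ (suc y) (s≤s z≤n) y≤top c)))

  tour-attains : Any (λ s → IsDist G (proj₁ s) (proj₂ s) h) (states tour)
  tour-attains = sweep-keeps _ n 0 _ (there (here tokens-at-distance-h))
    where
      tokens-at-distance-h : IsDist G (col (n + 0) , layer 0) (col (n + 0 + h) , layer 0) h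
      tokens-at-distance-h = subst₂ (λ x m → IsDist G (col (n + 0) , layer 0) (col x , layer 0) m)
        (+-comm h (n + 0)) (m≤n/2⇒m⊓[n∸m]≡m {n} ≤-refl) (layer-isDist (n + 0) h (layer 0) h≤n)

  span-attained : Σ ℕ λ l → Σ (Fin l → V G) λ f → Σ (Fin l → V G) λ g →
    IsLazyTrack G l f × IsLazyTrack G l g × Opposite G l f g × IsMinDist G l f g h
  span-attained =
    let (f-track , g-track , opposite) = run-tracks irrefl tour tour-coversˡ tour-coversʳ
    in length (states tour) , proj₁ ∘ lookup (states tour) , proj₂ ∘ lookup (states tour) ,
       f-track , g-track , opposite ,
       (index tour-attains , lookup-index tour-attains) ,
       λ i d d-isDist → ≤-trans (states-invariant tour i) (D≤length (proj₁ d-isDist))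

  cartesian-vertex-span : IsCartesianVertexSpan G h
  cartesian-vertex-span = span-attained , span-bounded

theorem1 : ∀ (n k : ℕ) → 3 ≤ n → 2 ≤ k →
    IsCartesianVertexSpan (MC n k) (n / 2)
theorem1 n k 3≤n 2≤k = MultilayeredCycle.cartesian-vertex-span n k (≤-trans (n≤1+n 2) 3≤n) 2≤k
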